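{- Let $A\in\mathrm{Avoid}(m,F(0,1,3,0))$. If there are three distinct rows $i,j,k$ with $i-j$, $j-k$ and $i\to k$ in $G(A)$, then one can delete two rows and at most four columns of $A$ so that the resulting matrix $A'$ is simple, i.e. $A'\in\mathrm{Avoid}(m-2,F(0,1,3,0))$.
   Context: A $(0,1)$-matrix is simple if it has no repeated columns; $\|A\|$ is its number of columns. $\mathrm{Avoid}(m,F)$ is the set of $m$-rowed simple matrices not containing $F$ as a configuration (a row and column permutation of a submatrix). $F(0,1,3,0)=\begin{bmatrix}1&0&0&0\\0&1&1&1\end{bmatrix}$. For such $A$, $G(A)$ is the graph on the rows of $A$ with: a directed edge $i\to j$ if no column of $A$ has $0$ in row $i$ and $1$ in row $j$; and an undirected edge $i-j$ if at most two columns of $A$ have ($0$ in row $i$, $1$ in row $j$), at most two columns have ($1$ in row $i$, $0$ in row $j$), and there is no directed edge between $i$ and $j$. -}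

module Defs where

open import Data.Nat using (ℕ; zero; suc; _+_; _≤_)
open import Data.Bool using (Bool; true; false; if_then_else_; _∧_)
import Data.Bool as B
open import Data.Fin using (Fin; zero; suc; _<_)
open import Data.Product using (Σ; ∃; _×_; _,_)
open import Relation.Nullary using (¬_)
open import Relation.Nullary.Decidable using (⌊_⌋)
open import Relation.Binary.PropositionalEquality using (_≡_; _≢_)

-- An m-rowed (0,1)-matrix with n columns; entry (row r, column c) is  A r c
-- (true = 1, false = 0).  n = ‖A‖.
Matrix : ℕ → ℕ → Set
Matrix m n = Fin m → Fin n → Bool

Simple : ∀ {m n} → Matrix m n → Set
Simple {m} {n} A = ∀ (c c' : Fin n) → (∀ (r : Fin m) → A r c ≡ A r c') → c ≡ c'

F0130 : Matrix 2 4
F0130 zero    zero = true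
F0130 zero    (suc _) = false
F0130 (suc _) zero = false
F0130 (suc _) (suc _) = true

Injective : ∀ {a b} → (Fin a → Fin b) → Set
Injective {a} f = ∀ (x y : Fin a) → f x ≡ f y → x ≡ y

-- A has F as a configuration: some choice of distinct rows and distinct
-- columns of A (in some order, which accounts for row/column permutations)
-- gives exactly F.
HasConfig : ∀ {m n p q} → Matrix p q → Matrix m n → Set
HasConfig {m} {n} {p} {q} F A =
  Σ (Fin p → Fin m) λ ρ → Σ (Fin q → Fin n) λ γ →
    Injective ρ × Injective γ × (∀ r c → A (ρ r) (γ c) ≡ F r c)

InAvoid : ∀ {m n p q} → Matrix p q → Matrix m n → Set
InAvoid F A = Simple A × ¬ HasConfig F A

countTrue : ∀ {n} → (Fin n → Bool) → ℕ
countTrue {zero}  p = 0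
countTrue {suc n} p = (if p zero then 1 else 0) + countTrue (λ c → p (suc c))

pairCount : ∀ {m n} → Matrix m n → Fin m → Fin m → Bool → Bool → ℕ
pairCount A i j a b = countTrue (λ c → ⌊ A i c B.≟ a ⌋ ∧ ⌊ A j c B.≟ b ⌋)

DirEdge : ∀ {m n} → Matrix m n → Fin m → Fin m → Set
DirEdge {m} {n} A i j = ¬ (∃ λ (c : Fin n) → A i c ≡ false × A j c ≡ true)

UndirEdge : ∀ {m n} → Matrix m n → Fin m → Fin m → Set
UndirEdge A i j =
  pairCount A i j false true ≤ 2 × pairCount A i j true false ≤ 2 ×
  ¬ DirEdge A i j × ¬ DirEdge A j i

-- strictly increasing index maps (used to describe deletion of rows/columns,
-- keeping the remaining ones in their original order)
StrictMono : ∀ {a b} → (Fin a → Fin b) → Set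
StrictMono {a} f = ∀ (x y : Fin a) → x < y → f x < f y

-- Keep the columns on which rows i and j both equal row k: there rows i and j
-- are copies of row k, so deleting them leaves the submatrix simple.  Because
-- i → k, no column has 0 over 1 in rows i, k, so every other column has 1 over
-- 0 in rows i, j or in rows j, k, and the undirected edges i − j and j − k allow
-- at most two columns of each kind.
module Submission where

open import Defs
open import Data.Nat using (ℕ; _+_; _∸_; _≤_)
open import Data.Fin using (Fin)
open import Data.Product using (Σ; _×_)
open import Relation.Binary.PropositionalEquality using (_≢_)

open import Data.Bool using (Bool; true; false; T; _∧_; _∨_; if_then_else_)
import Data.Bool as Bool
open import Data.Bool.Properties using (T-≡)
open import Data.Empty using (⊥-elim)
open import Data.Fin using (zero; suc; punchIn; punchOut; _≟_)
open import Data.Fin.Properties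
  using ( <-cmp; <-irrefl; ≤∧≢⇒<; <⇒≢
        ; punchIn-mono-≤; punchIn-injective; punchIn-punchOut; punchOut-injective)
open import Data.Nat using (zero; suc; z≤n; s≤s)
open import Data.Nat.Properties
  using (<⇒≤; ≤-refl; +-mono-≤; +-monoʳ-≤; +-commutativeSemigroup; module ≤-Reasoning)
open import Algebra.Properties.CommutativeSemigroup +-commutativeSemigroup using (interchange)
open import Data.Product using (_,_; ∃)
open import Function using (_∘_; Equivalence)
open import Relation.Binary.Definitions using (tri<; tri≈; tri>)
open import Relation.Binary.PropositionalEquality using (_≡_; refl; sym; trans; cong; subst)
open import Relation.Nullary using (¬_; yes; no)
open import Relation.Nullary.Decidable using (⌊_⌋; toWitness; _×-dec_)

StrictMono⇒Injective : ∀ {a b} {f : Fin a → Fin b} → StrictMono f → Injective f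
StrictMono⇒Injective mono x y fx≡fy with <-cmp x y
... | tri< x<y _ _ = ⊥-elim (<-irrefl fx≡fy (mono x y x<y))
... | tri≈ _ x≡y _ = x≡y
... | tri> _ _ y<x = ⊥-elim (<-irrefl (sym fx≡fy) (mono y x y<x))

punchIn-strictMono : ∀ {n} (i : Fin (suc n)) → StrictMono (punchIn i)
punchIn-strictMono i x y x<y =
  ≤∧≢⇒< (punchIn-mono-≤ i x y (<⇒≤ x<y)) (<⇒≢ x<y ∘ punchIn-injective i x y)

punchIn₂ : ∀ {m} {i j : Fin (2 + m)} → i ≢ j → Fin m → Fin (2 + m)
punchIn₂ {i = i} i≢j = punchIn i ∘ punchIn (punchOut i≢j)

punchIn₂-strictMono : ∀ {m} {i j : Fin (2 + m)} (i≢j : i ≢ j) → StrictMono (punchIn₂ i≢j)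
punchIn₂-strictMono {i = i} i≢j x y =
  punchIn-strictMono i _ _ ∘ punchIn-strictMono (punchOut i≢j) x y

punchIn₂-onto : ∀ {m} {i j : Fin (2 + m)} (i≢j : i ≢ j) →
  ∀ t → t ≢ i → t ≢ j → ∃ λ r → punchIn₂ i≢j r ≡ t
punchIn₂-onto {i = i} i≢j t t≢i t≢j =
  punchOut j′≢t′ , trans (cong (punchIn i) (punchIn-punchOut j′≢t′)) (punchIn-punchOut i≢t)
  where
  i≢t : i ≢ t
  i≢t = t≢i ∘ sym
  j′≢t′ : punchOut i≢j ≢ punchOut i≢t
  j′≢t′ = t≢j ∘ sym ∘ punchOut-injective i≢j i≢t

select : ∀ {n} (p : Fin n → Bool) → Fin (countTrue p) → Fin n
select {suc n} p r with p zero
select {suc n} p zero    | true  = zero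
select {suc n} p (suc r) | true  = suc (select (p ∘ suc) r)
select {suc n} p r       | false = suc (select (p ∘ suc) r)

select-strictMono : ∀ {n} (p : Fin n → Bool) → StrictMono (select p)
select-strictMono {suc n} p x y x<y with p zero
select-strictMono {suc n} p zero    (suc y) x<y       | true  = s≤s z≤n
select-strictMono {suc n} p (suc x) (suc y) (s≤s x<y) | true  =
  s≤s (select-strictMono (p ∘ suc) x y x<y)
select-strictMono {suc n} p x       y       x<y       | false =
  s≤s (select-strictMono (p ∘ suc) x y x<y)

select-T : ∀ {n} (p : Fin n → Bool) r → T (p (select p r))
select-T {suc n} p r with p zero in p0≡b
select-T {suc n} p zero    | true  = Equivalence.from T-≡ p0≡b
select-T {suc n} p (suc r) | true  = select-T (p ∘ suc) r
select-T {suc n} p r       | false = select-T (p ∘ suc) r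

if-∨-≤ : ∀ a b → (if a ∨ b then 1 else 0) ≤ (if a then 1 else 0) + (if b then 1 else 0)
if-∨-≤ true  _     = s≤s z≤n
if-∨-≤ false true  = ≤-refl
if-∨-≤ false false = z≤n

countTrue-∨ : ∀ {n} (p q : Fin n → Bool) →
  countTrue (λ c → p c ∨ q c) ≤ countTrue p + countTrue q
countTrue-∨ {zero}  p q = z≤n
countTrue-∨ {suc n} p q = begin
  bit (p zero ∨ q zero) + countTrue (λ c → p (suc c) ∨ q (suc c))
    ≤⟨ +-mono-≤ (if-∨-≤ (p zero) (q zero)) (countTrue-∨ (p ∘ suc) (q ∘ suc)) ⟩
  (bit (p zero) + bit (q zero)) + (countTrue (p ∘ suc) + countTrue (q ∘ suc))
    ≡⟨ interchange (bit (p zero)) (bit (q zero)) _ _ ⟩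
  (bit (p zero) + countTrue (p ∘ suc)) + (bit (q zero) + countTrue (q ∘ suc)) ∎
  where
  open ≤-Reasoning
  bit : Bool → ℕ
  bit b = if b then 1 else 0

countTrue-all : ∀ {n} (p : Fin n → Bool) → (∀ c → T (p c)) → countTrue p ≡ n
countTrue-all {zero}  p all = refl
countTrue-all {suc n} p all with p zero | all zero
... | true | _ = cong suc (countTrue-all (p ∘ suc) (all ∘ suc))

countTrue-cover : ∀ {n} (p q : Fin n → Bool) → (∀ c → T (p c ∨ q c)) →
  n ≤ countTrue p + countTrue q
countTrue-cover p q cover =
  subst (_≤ countTrue p + countTrue q) (countTrue-all (λ c → p c ∨ q c) cover) (countTrue-∨ p q)

HasConfig-submatrix : ∀ {m n m′ n′ p q} {F : Matrix p q} {A : Matrix m n}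
  {σ : Fin m′ → Fin m} {τ : Fin n′ → Fin n} → Injective σ → Injective τ →
  HasConfig F (λ r c → A (σ r) (τ c)) → HasConfig F A
HasConfig-submatrix {σ = σ} {τ} σ-inj τ-inj (ρ , γ , ρ-inj , γ-inj , A≡F) =
  σ ∘ ρ , τ ∘ γ ,
  (λ x y → ρ-inj x y ∘ σ-inj (ρ x) (ρ y)) ,
  (λ x y → γ-inj x y ∘ τ-inj (γ x) (γ y)) ,
  A≡F

Simple-submatrix : ∀ {m n m′ n′} {A : Matrix m n} {σ : Fin m′ → Fin m} {τ : Fin n′ → Fin n} →
  Simple A → Injective τ →
  (∀ c c′ → (∀ r → A (σ r) (τ c) ≡ A (σ r) (τ c′)) → ∀ t → A t (τ c) ≡ A t (τ c′)) →
  Simple (λ r c → A (σ r) (τ c))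
Simple-submatrix simple τ-inj determined c c′ same =
  τ-inj c c′ (simple _ _ (determined c c′ same))

punchIn₂-determines : ∀ {m} {i j k : Fin (2 + m)} (i≢j : i ≢ j) → k ≢ i → k ≢ j →
  (u v : Fin (2 + m) → Bool) → u i ≡ u k × u j ≡ u k → v i ≡ v k × v j ≡ v k →
  (∀ r → u (punchIn₂ i≢j r) ≡ v (punchIn₂ i≢j r)) → ∀ t → u t ≡ v t
punchIn₂-determines {i = i} {j} {k} i≢j k≢i k≢j u v (uᵢ≡uₖ , uⱼ≡uₖ) (vᵢ≡vₖ , vⱼ≡vₖ) same =
  agree
  where
  agree-outside : ∀ t → t ≢ i → t ≢ j → u t ≡ v t
  agree-outside t t≢i t≢j with punchIn₂-onto i≢j t t≢i t≢j
  ... | r , refl = same r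
  uₖ≡vₖ : u k ≡ v k
  uₖ≡vₖ = agree-outside k k≢i k≢j
  agree : ∀ t → u t ≡ v t
  agree t with t ≟ i | t ≟ j
  ... | yes refl | _        = trans uᵢ≡uₖ (trans uₖ≡vₖ (sym vᵢ≡vₖ))
  ... | no _     | yes refl = trans uⱼ≡uₖ (trans uₖ≡vₖ (sym vⱼ≡vₖ))
  ... | no t≢i   | no t≢j   = agree-outside t t≢i t≢j

column-cases : ∀ a b d → ¬ (a ≡ false × d ≡ true) →
  T (⌊ (a Bool.≟ d) ×-dec (b Bool.≟ d) ⌋ ∨
     (⌊ a Bool.≟ true ⌋ ∧ ⌊ b Bool.≟ false ⌋ ∨ ⌊ b Bool.≟ true ⌋ ∧ ⌊ d Bool.≟ false ⌋))
column-cases false false false _   = _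
column-cases false false true  ¬01 = ⊥-elim (¬01 (refl , refl))
column-cases false true  false _   = _
column-cases false true  true  ¬01 = ⊥-elim (¬01 (refl , refl))
column-cases true  false false _   = _
column-cases true  false true  _   = _
column-cases true  true  false _   = _
column-cases true  true  true  _   = _

copiesRow : ∀ {m n} → Matrix m n → Fin m → Fin m → Fin m → Fin n → Bool
copiesRow A i j k c = ⌊ (A i c Bool.≟ A k c) ×-dec (A j c Bool.≟ A k c) ⌋

n≤countTrue-copiesRow+4 : ∀ {m n} (A : Matrix m n) (i j k : Fin m) → DirEdge A i k →
  pairCount A i j true false ≤ 2 → pairCount A j k true false ≤ 2 →
  n ≤ countTrue (copiesRow A i j k) + 4
n≤countTrue-copiesRow+4 {n = n} A i j k i→k ij₁₀≤2 jk₁₀≤2 = begin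
  n
    ≤⟨ countTrue-cover keep (λ c → ij₁₀ c ∨ jk₁₀ c)
         (λ c → column-cases (A i c) (A j c) (A k c) (λ ik₀₁ → i→k (c , ik₀₁))) ⟩
  countTrue keep + countTrue (λ c → ij₁₀ c ∨ jk₁₀ c)
    ≤⟨ +-monoʳ-≤ (countTrue keep) (countTrue-∨ ij₁₀ jk₁₀) ⟩
  countTrue keep + (countTrue ij₁₀ + countTrue jk₁₀)
    ≤⟨ +-monoʳ-≤ (countTrue keep) (+-mono-≤ ij₁₀≤2 jk₁₀≤2) ⟩
  countTrue keep + 4 ∎
  where
  open ≤-Reasoning
  keep ij₁₀ jk₁₀ : Fin n → Bool
  keep = copiesRow A i j k
  ij₁₀ c = ⌊ A i c Bool.≟ true ⌋ ∧ ⌊ A j c Bool.≟ false ⌋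
  jk₁₀ c = ⌊ A j c Bool.≟ true ⌋ ∧ ⌊ A k c Bool.≟ false ⌋

lemma4p4 : (m n : ℕ) (A : Matrix m n) → InAvoid F0130 A →
    (i j k : Fin m) → i ≢ j → j ≢ k → i ≢ k →
    UndirEdge A i j → UndirEdge A j k → DirEdge A i k →
    Σ (Fin (m ∸ 2) → Fin m) λ σ → Σ ℕ λ n' → Σ (Fin n' → Fin n) λ τ →
      StrictMono σ × StrictMono τ × n ≤ n' + 4 ×
      InAvoid F0130 (λ r c → A (σ r) (τ c))
lemma4p4 zero          n A _ () _ _
lemma4p4 (suc zero)    n A _ zero zero _ i≢j = ⊥-elim (i≢j refl)
lemma4p4 (suc (suc m)) n A (simple , avoid) i j k i≢j j≢k i≢k
         (_ , ij₁₀≤2 , _) (_ , jk₁₀≤2 , _) i→k =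
  punchIn₂ i≢j , countTrue keep , select keep ,
  punchIn₂-strictMono i≢j , select-strictMono keep ,
  n≤countTrue-copiesRow+4 A i j k i→k ij₁₀≤2 jk₁₀≤2 ,
  Simple-submatrix simple τ-inj (λ c c′ →
    punchIn₂-determines i≢j (i≢k ∘ sym) (j≢k ∘ sym) _ _
      (toWitness (select-T keep c)) (toWitness (select-T keep c′))) ,
  avoid ∘ HasConfig-submatrix {A = A} (StrictMono⇒Injective (punchIn₂-strictMono i≢j)) τ-inj
  where
  keep : Fin n → Bool
  keep = copiesRow A i j k
  τ-inj : Injective (select keep)
  τ-inj = StrictMono⇒Injective (select-strictMono keep)
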